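{- The only solutions of the system of equations \[ a^2+b=c^z, \qquad a+b^2=c^Z \] in positive integers $a,b,c,z,Z$ with $\min\{a,b,c\}>1$ and $\gcd(a,b)=1$ are $(a,b,c,z,Z)=(2,5,3,2,3)$ and $(a,b,c,z,Z)=(5,2,3,3,2)$. -}

module Submission where

open import Data.Nat using (ℕ; zero; suc; _+_; _*_; _^_; _<_; _≤_; z≤n; s≤s; z<s; s≤s⁻¹; NonZero; >-nonZero)
open import Data.Nat.Properties
open import Data.Nat.Divisibility
open import Data.Nat.Coprimality using (Coprime; gcd≡1⇒coprime; coprime-divisor)
import Data.Nat.Coprimality as Coprimality
open import Data.Nat.GCD using (gcd)
open import Data.Nat.Tactic.RingSolver using (solve)
open import Data.Product using (∃-syntax; ∃₂; _×_; _,_)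
open import Data.Sum using (_⊎_; inj₁; inj₂; [_,_]′)
import Data.Sum as Sum
open import Data.List using (_∷_; [])
open import Relation.Nullary using (¬_; contradiction)
open import Relation.Binary.PropositionalEquality
open import Relation.Binary.Definitions using (tri<; tri≈; tri>)

-- Write A = a² + b and D = a + b².  By symmetry let b < a (a = b contradicts coprimality).
-- Then D < A < D², so Z < z < 2Z, and m = c^(z − Z), t = c^(2Z − z) satisfy A = D m,
-- D = m t, and m ∣ t or t ∣ m.  Since b (b³ + 1) + D² = A + 2b² D and gcd (D, b) = 1,
-- b³ + 1 = k D with 0 < k < b, and then b k + D = m + 2b².  As gcd (b, m) = 1 this forces
-- t = b s + 1 and k + m s = 2b.  With e = b − k the system becomes m s = k + 2e,
-- m k = b e² + 1, and m ∣ t or t ∣ m leaves only k = e = s = 1, m = 3.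

m*n>0⇒n>0 : ∀ m {n} → 0 < m * n → 0 < n
m*n>0⇒n>0 m {zero}  0<m*0 = contradiction (*-zeroʳ m) (n>0⇒n≢0 0<m*0)
m*n>0⇒n>0 m {suc n} _     = z<s

n≤n*n : ∀ n → n ≤ n * n
n≤n*n zero        = z≤n
n≤n*n n@(suc _)   = m≤m*n n n

square : ∀ n → n ^ 2 ≡ n * n
square n = cong (n *_) (*-identityʳ n)

m≤n⇒o^m∣o^n : ∀ o {m n} → m ≤ n → o ^ m ∣ o ^ n
m≤n⇒o^m∣o^n o {m} m≤n with m≤n⇒∃[o]m+o≡n m≤n
... | d , refl = divides (o ^ d) (trans (^-distribˡ-+-* o m d) (*-comm (o ^ m) (o ^ d)))

o^m∣o^n⊎o^n∣o^m : ∀ o m n → o ^ m ∣ o ^ n ⊎ o ^ n ∣ o ^ m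
o^m∣o^n⊎o^n∣o^m o m n = Sum.map (m≤n⇒o^m∣o^n o) (m≤n⇒o^m∣o^n o) (≤-total m n)

^-cancelʳ-≤ : ∀ {o m n} → 1 < o → o ^ m ≤ o ^ n → m ≤ n
^-cancelʳ-≤ {o} 1<o oᵐ≤oⁿ = ≮⇒≥ (λ n<m → <⇒≱ (^-monoʳ-< o 1<o n<m) oᵐ≤oⁿ)

m^n≡3⇒m≡3∧n≡1 : ∀ {m} n → 1 < m → m ^ n ≡ 3 → m ≡ 3 × n ≡ 1
m^n≡3⇒m≡3∧n≡1 zero          _   ()
m^n≡3⇒m≡3∧n≡1 {m} 1         _   mⁿ≡3 = trans (sym (*-identityʳ m)) mⁿ≡3 , refl
m^n≡3⇒m≡3∧n≡1 {m} (suc (suc n)) 1<m mⁿ≡3 = contradiction (sym mⁿ≡3) (<⇒≢ 3<mⁿ)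
  where
  3<mⁿ : 3 < m ^ (2 + n)
  3<mⁿ = ≤-trans (^-monoˡ-≤ 2 1<m)
                 (^-monoʳ-≤ m {{>-nonZero (<-trans z<s 1<m)}} {2} {2 + n} (s≤s (s≤s z≤n)))

coprime-+-∣ : ∀ {m n o} → Coprime m n → n ∣ o → Coprime (m + o) n
coprime-+-∣ {m} {n} {o} cop n∣o {i} (i∣m+o , i∣n) =
  cop (∣m+n∣m⇒∣n (subst (i ∣_) (+-comm m o) i∣m+o) (∣-trans i∣n n∣o) , i∣n)

coprime-∣ʳ : ∀ {m n o} → Coprime m n → o ∣ n → Coprime m o
coprime-∣ʳ cop o∣n (i∣m , i∣o) = cop (i∣m , ∣-trans i∣o o∣n)

m+n*n<m*m+n : ∀ {m n} → n < m → 0 < n → m + n * n < m * m + n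
m+n*n<m*m+n {m} {n} n<m 0<n = begin-strict
  m + n * n      ≤⟨ +-monoʳ-≤ m (*-monoˡ-≤ n (<⇒≤ n<m)) ⟩
  m + m * n      <⟨ m<m+n (m + m * n) 0<n ⟩
  m + m * n + n  ≡⟨ cong (_+ n) (sym (*-suc m n)) ⟩
  m * suc n + n  ≤⟨ +-monoˡ-≤ n (*-monoʳ-≤ m n<m) ⟩
  m * m + n      ∎
  where open ≤-Reasoning

m*m+n≤[m+n*n]*[m+n*n] : ∀ m n → m * m + n ≤ (m + n * n) * (m + n * n)
m*m+n≤[m+n*n]*[m+n*n] m n = begin
  m * m + n                  ≤⟨ +-monoʳ-≤ (m * m) (≤-trans (n≤n*n n) (n≤n*n N)) ⟩
  m * m + N * N              ≤⟨ +-mono-≤ (*-monoʳ-≤ m (m≤m+n m N)) (*-monoʳ-≤ N (m≤n+m N m)) ⟩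
  m * (m + N) + N * (m + N)  ≡⟨ sym (*-distribʳ-+ (m + N) m N) ⟩
  (m + N) * (m + N)          ∎
  where
  open ≤-Reasoning
  N = n * n

unit-solution : ∀ {k e s m} → e ≡ 1 → s ≡ 1 →
                m * s ≡ k + 2 * e → m * k ≡ (k + e) * (e * e) + 1 →
                k ≡ 1 × e ≡ 1 × s ≡ 1 × m ≡ 3
unit-solution {k} {m = m} refl refl m*1≡k+2 m*k≡k+2 = k≡1 , refl , refl , trans m≡k+2 (cong (_+ 2) k≡1)
  where
  open ≡-Reasoning
  m≡k+2 : m ≡ k + 2
  m≡k+2 = trans (sym (*-identityʳ m)) m*1≡k+2
  instance
    _ : NonZero m
    _ = >-nonZero (subst (0 <_) (sym m≡k+2) (≤-trans (s≤s z≤n) (m≤n+m 2 k)))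
  k≡1 : k ≡ 1
  k≡1 = *-cancelˡ-≡ k 1 m (begin
    m * k                   ≡⟨ m*k≡k+2 ⟩
    (k + 1) * (1 * 1) + 1   ≡⟨ solve (k ∷ []) ⟩
    k + 2 * 1               ≡⟨ m*1≡k+2 ⟨
    m * 1                   ∎)

no-solution-below-e*s : ∀ {k e s m} → m * s ≡ k + 2 * e → m * k ≡ (k + e) * (e * e) + 1 → ¬ m < e * s
no-solution-below-e*s {k} {e} {s} {m} ms≡k+2e mk≡be²+1 m<es = <-irrefl refl (begin-strict
  suc (e * e) * suc (suc (e * e))          ≤⟨ *-mono-≤ e²<m (s≤s e²<m) ⟩
  m * suc m                                ≤⟨ *-monoʳ-≤ m m<es ⟩
  m * (e * s)                              ≡⟨ solve (m ∷ e ∷ s ∷ []) ⟩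
  e * (m * s)                              ≡⟨ cong (e *_) ms≡k+2e ⟩
  e * (k + 2 * e)                          ≤⟨ *-monoʳ-≤ e (+-monoˡ-≤ (2 * e) k≤e³+1) ⟩
  e * (e * e * e + 1 + 2 * e)              ≡⟨ solve (e ∷ []) ⟩
  e * e * e * e + 2 * (e * e) + e          <⟨ +-monoʳ-< _ (s≤s (≤-trans (n≤n*n e) (n≤1+n (e * e)))) ⟩
  e * e * e * e + 2 * (e * e) + (2 + e * e) ≡⟨ solve (e ∷ []) ⟩
  suc (e * e) * suc (suc (e * e))          ∎)
  where
  open ≤-Reasoning
  e²<m : e * e < m
  e²<m = *-cancelʳ-< k (e * e) m (begin-strict
    e * e * k                        <⟨ m<m+n (e * e * k) (m≤n+m 1 (e * e * e)) ⟩
    e * e * k + (e * e * e + 1)      ≡⟨ solve (k ∷ e ∷ []) ⟩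
    (k + e) * (e * e) + 1            ≡⟨ mk≡be²+1 ⟨
    m * k                            ∎)
  cofactor-bound : ∀ d → suc (e * e) + d ≡ m → k + d * k ≡ e * e * e + 1
  cofactor-bound d e²+1+d≡m = +-cancelˡ-≡ (e * e * k) _ _ (begin-equality
    e * e * k + (k + d * k)          ≡⟨ solve (k ∷ e ∷ d ∷ []) ⟩
    (suc (e * e) + d) * k            ≡⟨ cong (_* k) e²+1+d≡m ⟩
    m * k                            ≡⟨ mk≡be²+1 ⟩
    (k + e) * (e * e) + 1            ≡⟨ solve (k ∷ e ∷ []) ⟩
    e * e * k + (e * e * e + 1)      ∎)
  k≤e³+1 : k ≤ e * e * e + 1
  k≤e³+1 = let d , e²+1+d≡m = m≤n⇒∃[o]m+o≡n e²<m
           in subst (k ≤_) (cofactor-bound d e²+1+d≡m) (m≤m+n k (d * k))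

solution-t∣m : ∀ {k e s m} → 0 < m * s →
               m * s ≡ k + 2 * e → m * k ≡ (k + e) * (e * e) + 1 →
               (k + e) * s + 1 ∣ m → k ≡ 1 × e ≡ 1 × s ≡ 1 × m ≡ 3
solution-t∣m {k} {e} {s} {m} 0<ms ms≡k+2e mk≡be²+1 (divides q m≡qt) =
  unit-solution e≡1 s≡1 ms≡k+2e mk≡be²+1
  where
  open ≤-Reasoning
  t = (k + e) * s + 1
  t*qs≡ms : t * (q * s) ≡ m * s
  t*qs≡ms = trans (sym (*-assoc t q s)) (cong (_* s) (trans (*-comm t q) (sym m≡qt)))
  0<s : 0 < s
  0<s = m*n>0⇒n>0 m 0<ms
  ms<t*2 : m * s < t * 2
  ms<t*2 = begin-strict
    m * s              ≡⟨ ms≡k+2e ⟩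
    k + 2 * e          ≤⟨ m≤m+n (k + 2 * e) k ⟩
    k + 2 * e + k      ≡⟨ solve (k ∷ e ∷ []) ⟩
    (k + e) * 2        ≤⟨ *-monoˡ-≤ 2 (m≤m*n (k + e) s {{>-nonZero 0<s}}) ⟩
    (k + e) * s * 2    <⟨ *-monoˡ-< 2 (m<m+n ((k + e) * s) z<s) ⟩
    t * 2              ∎
  qs≡1 : q * s ≡ 1
  qs≡1 = ≤-antisym (s≤s⁻¹ (*-cancelˡ-< t (q * s) 2 (subst (_< t * 2) (sym t*qs≡ms) ms<t*2)))
                   (m*n>0⇒n>0 t (subst (0 <_) (sym t*qs≡ms) 0<ms))
  s≡1 : s ≡ 1
  s≡1 = m*n≡1⇒n≡1 q s qs≡1
  e≡1 : e ≡ 1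
  e≡1 = sym (+-cancelˡ-≡ (k + e) 1 e (begin-equality
    k + e + 1              ≡⟨ solve (k ∷ e ∷ []) ⟩
    (k + e) * 1 + 1        ≡⟨ cong (λ x → (k + e) * x + 1) s≡1 ⟨
    t                      ≡⟨ *-identityʳ t ⟨
    t * 1                  ≡⟨ cong (t *_) qs≡1 ⟨
    t * (q * s)            ≡⟨ t*qs≡ms ⟩
    m * s                  ≡⟨ ms≡k+2e ⟩
    k + 2 * e              ≡⟨ solve (k ∷ e ∷ []) ⟩
    k + e + e              ∎))

solution-m∣t : ∀ {k e s m} → 0 < e → 0 < s →
               m * s ≡ k + 2 * e → m * k ≡ (k + e) * (e * e) + 1 →
               m ∣ (k + e) * s + 1 → k ≡ 1 × e ≡ 1 × s ≡ 1 × m ≡ 3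
solution-m∣t {k} {suc e'} {suc s'} {m} z<s z<s ms≡k+2e mk≡be²+1 m∣t =
  m∣es-1⇒solution (s' + e' * suc s') refl m∣es-1
  where
  e = suc e'
  s = suc s'
  -- s' + e' * suc s' is e * s − 1 without truncated subtraction: e * s reduces to its successor
  t+[es-1]≡m*s*s : (k + e) * s + 1 + (s' + e' * s) ≡ m * s * s
  t+[es-1]≡m*s*s = begin
    (k + suc e') * suc s' + 1 + (s' + e' * suc s')   ≡⟨ solve (k ∷ e' ∷ s' ∷ []) ⟩
    (k + 2 * suc e') * suc s'                         ≡⟨ cong (_* s) ms≡k+2e ⟨
    m * s * s                                         ∎
    where open ≡-Reasoning
  m∣es-1 : m ∣ s' + e' * s
  m∣es-1 = ∣m+n∣m⇒∣n (subst (m ∣_) (sym t+[es-1]≡m*s*s) (∣m⇒∣m*n s (m∣m*n s))) m∣t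
  m∣es-1⇒solution : ∀ w → s' + e' * s ≡ w → m ∣ w → k ≡ 1 × e ≡ 1 × s ≡ 1 × m ≡ 3
  m∣es-1⇒solution zero    es-1≡0 _ =
    unit-solution (cong suc (m*n≡0⇒m≡0 e' s (m+n≡0⇒n≡0 s' es-1≡0)))
                  (cong suc (m+n≡0⇒m≡0 s' es-1≡0)) ms≡k+2e mk≡be²+1
  m∣es-1⇒solution (suc w) es-1≡1+w m∣1+w =
    contradiction (s≤s (subst (m ≤_) (sym es-1≡1+w) (∣⇒≤ m∣1+w)))
                  (no-solution-below-e*s ms≡k+2e mk≡be²+1)

reduced-system-solution : ∀ {k e s m} → 0 < e →
                          m * s ≡ k + 2 * e → m * k ≡ (k + e) * (e * e) + 1 →
                          m ∣ (k + e) * s + 1 ⊎ (k + e) * s + 1 ∣ m →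
                          k ≡ 1 × e ≡ 1 × s ≡ 1 × m ≡ 3
reduced-system-solution {k} {e} {s} {m} 0<e ms≡k+2e mk≡be²+1 =
  [ solution-m∣t 0<e (m*n>0⇒n>0 m 0<ms) ms≡k+2e mk≡be²+1 , solution-t∣m 0<ms ms≡k+2e mk≡be²+1 ]′
  where
  0<ms : 0 < m * s
  0<ms = subst (0 <_) (sym ms≡k+2e) (<-≤-trans 0<e (≤-trans (m≤m+n e (e + 0)) (m≤n+m (2 * e) k)))

cube+1-identity : ∀ a b {m} → a * a + b ≡ (a + b * b) * m →
                  b * (b * b * b + 1) + (a + b * b) * (a + b * b) ≡ (a + b * b) * (m + 2 * (b * b))
cube+1-identity a b {m} A≡Dm = begin
  b * (b * b * b + 1) + (a + b * b) * (a + b * b)  ≡⟨ solve (a ∷ b ∷ []) ⟩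
  a * a + b + (a + b * b) * (2 * (b * b))          ≡⟨ cong (_+ (a + b * b) * (2 * (b * b))) A≡Dm ⟩
  (a + b * b) * m + (a + b * b) * (2 * (b * b))    ≡⟨ *-distribˡ-+ (a + b * b) m (2 * (b * b)) ⟨
  (a + b * b) * (m + 2 * (b * b))                  ∎
  where open ≡-Reasoning

sum∣cube+1 : ∀ {a b m} → Coprime a b → a * a + b ≡ (a + b * b) * m → a + b * b ∣ b * b * b + 1
sum∣cube+1 {a} {b} cop A≡Dm = coprime-divisor (coprime-+-∣ cop (m∣m*n b)) D∣b[b³+1]
  where
  D = a + b * b
  D∣b[b³+1] : D ∣ b * (b * b * b + 1)
  D∣b[b³+1] = ∣m+n∣m⇒∣n (subst (D ∣_) (trans (sym (cube+1-identity a b A≡Dm)) (+-comm _ (D * D))) (m∣m*n _))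
                        (m∣m*n D)

cofactor-equation : ∀ a b {m k} .{{_ : NonZero (a + b * b)}} →
                    a * a + b ≡ (a + b * b) * m → b * b * b + 1 ≡ k * (a + b * b) →
                    b * k + (a + b * b) ≡ m + 2 * (b * b)
cofactor-equation a b {m} {k} A≡Dm b³+1≡kD = *-cancelˡ-≡ _ _ (a + b * b) (begin
  (a + b * b) * (b * k + (a + b * b))              ≡⟨ solve (a ∷ b ∷ k ∷ []) ⟩
  b * (k * (a + b * b)) + (a + b * b) * (a + b * b) ≡⟨ cong (λ x → b * x + (a + b * b) * (a + b * b)) b³+1≡kD ⟨
  b * (b * b * b + 1) + (a + b * b) * (a + b * b)  ≡⟨ cube+1-identity a b A≡Dm ⟩
  (a + b * b) * (m + 2 * (b * b))                  ∎)
  where open ≡-Reasoning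

cofactor<b : ∀ {a b k} → 1 < b * a → b * b * b + 1 ≡ k * (a + b * b) → k < b
cofactor<b {a} {b} {k} 1<ba b³+1≡kD = *-cancelʳ-< (a + b * b) k b (begin-strict
  k * (a + b * b)    ≡⟨ b³+1≡kD ⟨
  b * b * b + 1      <⟨ +-monoʳ-< (b * b * b) 1<ba ⟩
  b * b * b + b * a  ≡⟨ solve (a ∷ b ∷ []) ⟩
  b * (a + b * b)    ∎)
  where open ≤-Reasoning

t≡b*s+1∧k+m*s≡2*b : ∀ {b k m t} .{{_ : NonZero b}} → Coprime b m → 0 < t →
                    b * k + m * t ≡ m + 2 * (b * b) →
                    ∃[ s ] t ≡ b * s + 1 × k + m * s ≡ 2 * b
t≡b*s+1∧k+m*s≡2*b {b} {k} {m} {suc t'} cop z<s bk+mt≡m+2b² =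
  let b∣t' = coprime-divisor cop b∣m*t'
  in quotient b∣t' , from-quotient (m∣n⇒n≡quotient*m b∣t')
  where
  open ≡-Reasoning
  bk+mt'≡2b² : b * k + m * t' ≡ 2 * (b * b)
  bk+mt'≡2b² = +-cancelˡ-≡ m _ _ (begin
    m + (b * k + m * t')  ≡⟨ solve (b ∷ k ∷ m ∷ t' ∷ []) ⟩
    b * k + m * suc t'    ≡⟨ bk+mt≡m+2b² ⟩
    m + 2 * (b * b)       ∎)
  b∣m*t' : b ∣ m * t'
  b∣m*t' = ∣m+n∣m⇒∣n (subst (b ∣_) (sym bk+mt'≡2b²) (∣n⇒∣m*n 2 (m∣m*n b))) (m∣m*n k)
  from-quotient : ∀ {s} → t' ≡ s * b → suc t' ≡ b * s + 1 × k + m * s ≡ 2 * b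
  from-quotient {s} t'≡sb = trans (cong suc t'≡sb) (solve (s ∷ b ∷ [])) , *-cancelˡ-≡ _ _ b (begin
    b * (k + m * s)      ≡⟨ solve (b ∷ k ∷ m ∷ s ∷ []) ⟩
    b * k + m * (s * b)  ≡⟨ cong (λ x → b * k + m * x) t'≡sb ⟨
    b * k + m * t'       ≡⟨ bk+mt'≡2b² ⟩
    2 * (b * b)          ≡⟨ solve (b ∷ []) ⟩
    b * (2 * b)          ∎)

reduced-equations : ∀ {b k e s m t} → b ≡ k + e → t ≡ b * s + 1 → k + m * s ≡ 2 * b →
                    b * b * b + 1 ≡ k * (m * t) →
                    m * s ≡ k + 2 * e × m * k ≡ (k + e) * (e * e) + 1
reduced-equations {k = k} {e} {s} {m} refl refl k+ms≡2b b³+1≡kmt = ms≡k+2e , mk≡be²+1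
  where
  open ≡-Reasoning
  ms≡k+2e : m * s ≡ k + 2 * e
  ms≡k+2e = +-cancelˡ-≡ k _ _ (begin
    k + m * s        ≡⟨ k+ms≡2b ⟩
    2 * (k + e)      ≡⟨ solve (k ∷ e ∷ []) ⟩
    k + (k + 2 * e)  ∎)
  mk≡be²+1 : m * k ≡ (k + e) * (e * e) + 1
  mk≡be²+1 = +-cancelˡ-≡ (k * (k + e) * (k + 2 * e)) _ _ (begin
    k * (k + e) * (k + 2 * e) + m * k                    ≡⟨ cong (λ x → k * (k + e) * x + m * k) ms≡k+2e ⟨
    k * (k + e) * (m * s) + m * k                        ≡⟨ solve (k ∷ e ∷ s ∷ m ∷ []) ⟩
    k * (m * ((k + e) * s + 1))                          ≡⟨ b³+1≡kmt ⟨
    (k + e) * (k + e) * (k + e) + 1                      ≡⟨ solve (k ∷ e ∷ []) ⟩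
    k * (k + e) * (k + 2 * e) + ((k + e) * (e * e) + 1)  ∎)

factored-system-solution : ∀ {a b m t} → 0 < a → 1 < b → Coprime a b →
                           a * a + b ≡ (a + b * b) * m → a + b * b ≡ m * t → m ∣ t ⊎ t ∣ m →
                           a ≡ 5 × b ≡ 2 × m ≡ 3 × t ≡ 3
factored-system-solution {a} {b} {m} {t} 0<a 1<b cop A≡Dm D≡mt m∣t⊎t∣m =
  let divides k b³+1≡kD    = sum∣cube+1 cop A≡Dm
      e' , 1+k+e'≡b        = m≤n⇒∃[o]m+o≡n (cofactor<b (*-mono-≤ 1<b 0<a) b³+1≡kD)
      b≡k+e                = trans (sym 1+k+e'≡b) (sym (+-suc k e'))
      bk+mt≡m+2b²          = subst (λ x → b * k + x ≡ m + 2 * (b * b)) D≡mt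
                                   (cofactor-equation a b A≡Dm b³+1≡kD)
      s , t≡bs+1 , k+ms≡2b = t≡b*s+1∧k+m*s≡2*b b-coprime-m 0<t bk+mt≡m+2b²
      t≡[k+e]s+1           = trans t≡bs+1 (cong (λ x → x * s + 1) b≡k+e)
      ms≡k+2e , mk≡be²+1   = reduced-equations {s = s} {m} b≡k+e t≡bs+1 k+ms≡2b
                                               (trans b³+1≡kD (cong (k *_) D≡mt))
      k≡1 , e≡1 , s≡1 , m≡3 = reduced-system-solution {k} {suc e'} {s} {m} z<s ms≡k+2e mk≡be²+1
                                (subst (λ x → m ∣ x ⊎ x ∣ m) t≡[k+e]s+1 m∣t⊎t∣m)
  in back-substitution k≡1 e≡1 s≡1 m≡3 b≡k+e t≡bs+1 D≡mt
  where
  0<D : 0 < a + b * b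
  0<D = ≤-trans 0<a (m≤m+n a (b * b))
  instance
    _ : NonZero b
    _ = >-nonZero (<-trans z<s 1<b)
    _ : NonZero (a + b * b)
    _ = >-nonZero 0<D
  0<t : 0 < t
  0<t = m*n>0⇒n>0 m (subst (0 <_) D≡mt 0<D)
  b-coprime-m : Coprime b m
  b-coprime-m = coprime-∣ʳ (Coprimality.sym (coprime-+-∣ cop (m∣m*n b)))
                           (subst (m ∣_) (sym D≡mt) (m∣m*n t))
  back-substitution : ∀ {k e s} → k ≡ 1 → e ≡ 1 → s ≡ 1 → m ≡ 3 → b ≡ k + e → t ≡ b * s + 1 →
                      a + b * b ≡ m * t → a ≡ 5 × b ≡ 2 × m ≡ 3 × t ≡ 3
  back-substitution refl refl refl refl refl refl a+4≡9 = +-cancelʳ-≡ 4 a 5 a+4≡9 , refl , refl , refl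

exponents-split : ∀ {o} x y → 1 < o → o ^ y ≤ o ^ x → o ^ x ≤ o ^ y * o ^ y →
                  ∃₂ λ p q → x ≡ y + p × y ≡ p + q
exponents-split {o} x y 1<o oʸ≤oˣ oˣ≤oʸoʸ =
  let p , y+p≡x = m≤n⇒∃[o]m+o≡n (^-cancelʳ-≤ {o} {y} {x} 1<o oʸ≤oˣ)
      x≤y+y     = ^-cancelʳ-≤ {o} {x} {y + y} 1<o
                    (subst (o ^ x ≤_) (sym (^-distribˡ-+-* o y y)) oˣ≤oʸoʸ)
      q , p+q≡y = m≤n⇒∃[o]m+o≡n (+-cancelˡ-≤ y p y (subst (_≤ y + y) (sym y+p≡x) x≤y+y))
  in p , q , sym y+p≡x , sym p+q≡y

solution-with-b<a : ∀ {a b c z Z} → b < a → 1 < b → 1 < c → Coprime a b →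
                    a ^ 2 + b ≡ c ^ z → a + b ^ 2 ≡ c ^ Z →
                    a ≡ 5 × b ≡ 2 × c ≡ 3 × z ≡ 3 × Z ≡ 2
solution-with-b<a {a} {b} {c} {z} {Z} b<a 1<b 1<c cop a²+b≡cᶻ a+b²≡cᶻ =
  let p , q , z≡Z+p , Z≡p+q     = exponents-split z Z 1<c (<⇒≤ D<A) A≤D*D
      a≡5 , b≡2 , cᵖ≡3 , c^q≡3 = factored-system-solution (≤-<-trans z≤n b<a) 1<b cop
                                   (A≡Dcᵖ p z≡Z+p) (D≡cᵖc^q p q Z≡p+q) (o^m∣o^n⊎o^n∣o^m c p q)
      c≡3 , p≡1               = m^n≡3⇒m≡3∧n≡1 p 1<c cᵖ≡3
      _ , q≡1                 = m^n≡3⇒m≡3∧n≡1 q 1<c c^q≡3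
      Z≡2                     = trans Z≡p+q (cong₂ _+_ p≡1 q≡1)
  in a≡5 , b≡2 , c≡3 , trans z≡Z+p (cong₂ _+_ Z≡2 p≡1) , Z≡2
  where
  A≡cᶻ : a * a + b ≡ c ^ z
  A≡cᶻ = trans (cong (_+ b) (sym (square a))) a²+b≡cᶻ
  D≡cᶻ : a + b * b ≡ c ^ Z
  D≡cᶻ = trans (cong (a +_) (sym (square b))) a+b²≡cᶻ
  D<A : c ^ Z < c ^ z
  D<A = subst₂ _<_ D≡cᶻ A≡cᶻ (m+n*n<m*m+n b<a (<-trans z<s 1<b))
  A≤D*D : c ^ z ≤ c ^ Z * c ^ Z
  A≤D*D = subst₂ _≤_ A≡cᶻ (cong₂ _*_ D≡cᶻ D≡cᶻ) (m*m+n≤[m+n*n]*[m+n*n] a b)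
  D≡cᵖc^q : ∀ p q → Z ≡ p + q → a + b * b ≡ c ^ p * c ^ q
  D≡cᵖc^q p q Z≡p+q = trans D≡cᶻ (trans (cong (c ^_) Z≡p+q) (^-distribˡ-+-* c p q))
  A≡Dcᵖ : ∀ p → z ≡ Z + p → a * a + b ≡ (a + b * b) * c ^ p
  A≡Dcᵖ p z≡Z+p = trans A≡cᶻ (trans (cong (c ^_) z≡Z+p)
                               (trans (^-distribˡ-+-* c Z p) (cong (_* c ^ p) (sym D≡cᶻ))))

theorem1 : (a b c z Z : ℕ) → 1 < a → 1 < b → 1 < c → 1 ≤ z → 1 ≤ Z →
    gcd a b ≡ 1 → a ^ 2 + b ≡ c ^ z → a + b ^ 2 ≡ c ^ Z →
    (a ≡ 2 × b ≡ 5 × c ≡ 3 × z ≡ 2 × Z ≡ 3) ⊎ (a ≡ 5 × b ≡ 2 × c ≡ 3 × z ≡ 3 × Z ≡ 2)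
theorem1 a b c z Z 1<a 1<b 1<c _ _ gcd≡1 a²+b≡cᶻ a+b²≡cᶻ with gcd≡1⇒coprime gcd≡1 | <-cmp a b
... | cop | tri> _ _ b<a = inj₂ (solution-with-b<a b<a 1<b 1<c cop a²+b≡cᶻ a+b²≡cᶻ)
... | cop | tri< a<b _ _ =
  let b≡5 , a≡2 , c≡3 , Z≡3 , z≡2 = solution-with-b<a a<b 1<a 1<c (Coprimality.sym cop)
                                      (trans (+-comm (b ^ 2) a) a+b²≡cᶻ) (trans (+-comm b (a ^ 2)) a²+b≡cᶻ)
  in inj₁ (a≡2 , b≡5 , c≡3 , z≡2 , Z≡3)
... | cop | tri≈ _ refl _ = contradiction (cop (∣-refl , ∣-refl)) (>⇒≢ 1<a)
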